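{- Every positive integer $n$ admits exactly one hyperbinary expansion containing no digit $0$.
   Context: A hyperbinary expansion of a positive integer $n$ is a word $x_1\cdots x_k$ over the alphabet $\{0,1,2\}$ with $x_1\neq 0$ and $n=\sum_{i=1}^k x_i2^{k-i}$. -}

module Defs where

open import Data.Nat using (ℕ; zero; suc; _+_; _*_)
open import Data.Fin using (Fin; toℕ)
open import Data.List using (List; []; _∷_; foldl)
open import Data.List.Relation.Unary.All using (All)
open import Relation.Binary.PropositionalEquality using (_≡_)
open import Relation.Nullary using (¬_)
open import Data.Product using (_×_)
open import Data.Empty using (⊥)
open import Data.Unit using (⊤)

Digit : Set
Digit = Fin 3

-- A word x₁ ⋯ x_k, listed most significant digit first.
Word : Set
Word = List Digit

value : Word → ℕ
value = foldl (λ acc d → 2 * acc + toℕ d) 0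

LeadingNonzero : Word → Set
LeadingNonzero []      = ⊥
LeadingNonzero (d ∷ _) = ¬ (toℕ d ≡ 0)

HyperbinaryExpansion : ℕ → Word → Set
HyperbinaryExpansion n w = LeadingNonzero w × value w ≡ n

NoZeroDigit : Word → Set
NoZeroDigit w = All (λ d → ¬ (toℕ d ≡ 0)) w

-- Zero-free hyperbinary expansions are exactly the numerals of bijective base 2 (digits 1 and 2).
-- Read from the least significant end, every n > 0 has one: n is reached from 0 by repeated
-- increments, which never create a 0 since a carry turns 2 into 1. It is unique because the last
-- digit d ∈ {1, 2} of an expansion of n is forced by the parity of n, and the remaining digits
-- then expand (n − d) / 2.
module Submission where

open import Defs
open import Data.Nat using (ℕ; _>_; zero; suc; _+_; _*_)
open import Data.Nat.Divisibility using (_∣_; ∣m+n∣m⇒∣n; m∣m*n; ∣1⇒≡1)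
open import Data.Nat.Properties using (+-comm; *-suc; *-cancelˡ-≡; suc-injective; m+n≡0⇒m≡0)
open import Data.Fin using (toℕ) renaming (zero to fzero; suc to fsuc)
open import Data.List using (List; []; _∷_; foldr; reverse; reverseAcc)
open import Data.List.Properties using (foldl-ʳ++; foldr-cong; reverse-involutive; reverse-injective)
open import Data.List.Relation.Unary.All using (All; []; _∷_)
open import Data.Product using (Σ; _×_; _,_)
open import Data.Empty using (⊥-elim)
open import Function using (case_of_)
open import Relation.Nullary using (¬_)
open import Relation.Binary.PropositionalEquality
  using (_≡_; _≢_; refl; sym; trans; cong; subst; module ≡-Reasoning)
open ≡-Reasoning

pattern d0 = fzero
pattern d1 = fsuc fzero
pattern d2 = fsuc (fsuc fzero)

NonzeroDigit : Digit → Set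
NonzeroDigit d = ¬ toℕ d ≡ 0

All-reverseAcc⁺ : ∀ {a p} {A : Set a} {P : A → Set p} {acc xs : List A} →
                  All P acc → All P xs → All P (reverseAcc acc xs)
All-reverseAcc⁺ pacc []         = pacc
All-reverseAcc⁺ pacc (px ∷ pxs) = All-reverseAcc⁺ (px ∷ pacc) pxs

All-reverse⁺ : ∀ {a p} {A : Set a} {P : A → Set p} {xs : List A} →
               All P xs → All P (reverse xs)
All-reverse⁺ = All-reverseAcc⁺ []

odd≢even : ∀ a b → suc (2 * a) ≢ 2 * b
odd≢even a b eq = case ∣1⇒≡1 (∣m+n∣m⇒∣n 2∣2a+1 (m∣m*n a)) of λ ()
  where
  2∣2a+1 : 2 ∣ 2 * a + 1
  2∣2a+1 = subst (2 ∣_) (trans (sym eq) (+-comm 1 (2 * a))) (m∣m*n b)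

valueᴸ : Word → ℕ
valueᴸ = foldr (λ d acc → toℕ d + 2 * acc) 0

value-reverse : ∀ u → value (reverse u) ≡ valueᴸ u
value-reverse u = begin
  value (reverse u)                            ≡⟨ foldl-ʳ++ (λ acc d → 2 * acc + toℕ d) 0 u ⟩
  foldr (λ d acc → 2 * acc + toℕ d) 0 u        ≡⟨ foldr-cong (λ d acc → +-comm (2 * acc) (toℕ d)) refl u ⟩
  valueᴸ u                                     ∎

valueᴸ-reverse : ∀ w → valueᴸ (reverse w) ≡ value w
valueᴸ-reverse w = trans (sym (value-reverse (reverse w))) (cong value (reverse-involutive w))

increment : Word → Word
increment []       = d1 ∷ []
increment (d0 ∷ u) = d1 ∷ u
increment (d1 ∷ u) = d2 ∷ u
increment (d2 ∷ u) = d1 ∷ increment u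

valueᴸ-increment : ∀ u → valueᴸ (increment u) ≡ suc (valueᴸ u)
valueᴸ-increment []       = refl
valueᴸ-increment (d0 ∷ u) = refl
valueᴸ-increment (d1 ∷ u) = refl
valueᴸ-increment (d2 ∷ u) = begin
  suc (2 * valueᴸ (increment u))  ≡⟨ cong (λ m → suc (2 * m)) (valueᴸ-increment u) ⟩
  suc (2 * suc (valueᴸ u))        ≡⟨ cong suc (*-suc 2 (valueᴸ u)) ⟩
  suc (2 + 2 * valueᴸ u)          ∎

increment-NoZeroDigit : ∀ {u} → NoZeroDigit u → NoZeroDigit (increment u)
increment-NoZeroDigit {[]}     []       = (λ ()) ∷ []
increment-NoZeroDigit {d0 ∷ u} (p ∷ ps) = ⊥-elim (p refl)
increment-NoZeroDigit {d1 ∷ u} (p ∷ ps) = (λ ()) ∷ ps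
increment-NoZeroDigit {d2 ∷ u} (p ∷ ps) = (λ ()) ∷ increment-NoZeroDigit ps

bijectiveDigitsᴸ : ℕ → Word
bijectiveDigitsᴸ zero    = []
bijectiveDigitsᴸ (suc n) = increment (bijectiveDigitsᴸ n)

valueᴸ-bijectiveDigitsᴸ : ∀ n → valueᴸ (bijectiveDigitsᴸ n) ≡ n
valueᴸ-bijectiveDigitsᴸ zero    = refl
valueᴸ-bijectiveDigitsᴸ (suc n) =
  trans (valueᴸ-increment (bijectiveDigitsᴸ n)) (cong suc (valueᴸ-bijectiveDigitsᴸ n))

bijectiveDigitsᴸ-NoZeroDigit : ∀ n → NoZeroDigit (bijectiveDigitsᴸ n)
bijectiveDigitsᴸ-NoZeroDigit zero    = []
bijectiveDigitsᴸ-NoZeroDigit (suc n) = increment-NoZeroDigit (bijectiveDigitsᴸ-NoZeroDigit n)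

lowestDigit-unique : ∀ {d e} a b → NonzeroDigit d → NonzeroDigit e →
                     toℕ d + 2 * a ≡ toℕ e + 2 * b → d ≡ e × a ≡ b
lowestDigit-unique {d0}      _ _ p _ _  = ⊥-elim (p refl)
lowestDigit-unique {_} {d0}  _ _ _ q _  = ⊥-elim (q refl)
lowestDigit-unique {d1} {d1} a b _ _ eq = refl , *-cancelˡ-≡ a b 2 (suc-injective eq)
lowestDigit-unique {d2} {d2} a b _ _ eq = refl , *-cancelˡ-≡ a b 2 (suc-injective (suc-injective eq))
lowestDigit-unique {d1} {d2} a b _ _ eq = ⊥-elim (odd≢even a (suc b) (trans eq (sym (*-suc 2 b))))
lowestDigit-unique {d2} {d1} a b _ _ eq = ⊥-elim (odd≢even b (suc a) (trans (sym eq) (sym (*-suc 2 a))))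

valueᴸ-injective : ∀ {u v} → NoZeroDigit u → NoZeroDigit v → valueᴸ u ≡ valueᴸ v → u ≡ v
valueᴸ-injective []       []       _  = refl
valueᴸ-injective []       (q ∷ _)  eq = ⊥-elim (q (m+n≡0⇒m≡0 _ (sym eq)))
valueᴸ-injective (p ∷ _)  []       eq = ⊥-elim (p (m+n≡0⇒m≡0 _ eq))
valueᴸ-injective {_ ∷ u} {_ ∷ v} (p ∷ ps) (q ∷ qs) eq
  with refl , u≡v ← lowestDigit-unique (valueᴸ u) (valueᴸ v) p q eq
  = cong (_ ∷_) (valueᴸ-injective ps qs u≡v)

value-injective : ∀ {v w} → NoZeroDigit v → NoZeroDigit w → value v ≡ value w → v ≡ w
value-injective {v} {w} nv nw eq = reverse-injective
  (valueᴸ-injective (All-reverse⁺ nv) (All-reverse⁺ nw)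
    (trans (valueᴸ-reverse v) (trans eq (sym (valueᴸ-reverse w)))))

bijectiveDigits : ℕ → Word
bijectiveDigits n = reverse (bijectiveDigitsᴸ n)

value-bijectiveDigits : ∀ n → value (bijectiveDigits n) ≡ n
value-bijectiveDigits n = trans (value-reverse (bijectiveDigitsᴸ n)) (valueᴸ-bijectiveDigitsᴸ n)

bijectiveDigits-NoZeroDigit : ∀ n → NoZeroDigit (bijectiveDigits n)
bijectiveDigits-NoZeroDigit n = All-reverse⁺ (bijectiveDigitsᴸ-NoZeroDigit n)

NoZeroDigit⇒LeadingNonzero : ∀ {w} → NoZeroDigit w → value w > 0 → LeadingNonzero w
NoZeroDigit⇒LeadingNonzero {[]}    _       ()
NoZeroDigit⇒LeadingNonzero {_ ∷ _} (p ∷ _) _ = p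

proposition2p4 : (n : ℕ) → n > 0 →
    Σ Word (λ w → (HyperbinaryExpansion n w × NoZeroDigit w) ×
      ((w′ : Word) → HyperbinaryExpansion n w′ → NoZeroDigit w′ → w′ ≡ w))
proposition2p4 n n>0 = bijectiveDigits n , ((leading , value-bijectiveDigits n) , noZero) , unique
  where
  noZero : NoZeroDigit (bijectiveDigits n)
  noZero = bijectiveDigits-NoZeroDigit n

  leading : LeadingNonzero (bijectiveDigits n)
  leading = NoZeroDigit⇒LeadingNonzero noZero (subst (_> 0) (sym (value-bijectiveDigits n)) n>0)

  unique : (w′ : Word) → HyperbinaryExpansion n w′ → NoZeroDigit w′ → w′ ≡ bijectiveDigits n
  unique w′ (_ , value-w′) noZero′ =
    value-injective noZero′ noZero (trans value-w′ (sym (value-bijectiveDigits n)))
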